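{- For every integer $k\geq 1$ there exists a balanced edge-coloring of the complete graph $K_{13^k}$ with $6$ colors that contains no rainbow copy of $K_4$.
   Context: An edge-coloring of the complete graph $K_n$ is called balanced if every vertex is incident to the same number of edges of each color. A copy of a graph $H$ in an edge-colored $K_n$ is rainbow if all of its edges receive pairwise different colors; thus a rainbow $K_4$ is a set of four vertices whose six connecting edges all have distinct colors. -}

module Defs where

open import Data.Nat using (ℕ)
open import Data.Fin using (Fin; _≟_)
open import Data.Fin.Properties using (all?)
open import Data.List using (List; []; _∷_; length; filter; allFin)
open import Data.List.Relation.Unary.Unique.Propositional using (Unique)
open import Data.Product using (_×_)
open import Relation.Nullary using (¬_)
open import Relation.Nullary.Decidable using (¬?; _×-dec_)
open import Relation.Binary.PropositionalEquality using (_≡_; _≢_)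

-- An edge-coloring of K_n with m colors: a symmetric assignment of a color
-- to each ordered pair of vertices; values on the diagonal (u , u) are
-- irrelevant (they are never used below).
record EdgeColoring (n m : ℕ) : Set where
  field
    col : Fin n → Fin n → Fin m
    sym : ∀ u v → col u v ≡ col v u
open EdgeColoring public

colorDegree : ∀ {n m} → EdgeColoring n m → Fin n → Fin m → ℕ
colorDegree {n} c v i =
  length (filter (λ u → ¬? (u ≟ v) ×-dec (col c v u ≟ i)) (allFin n))

Balanced : ∀ {n m} → EdgeColoring n m → Set
Balanced {n} {m} c = ∀ (v : Fin n) (i j : Fin m) → colorDegree c v i ≡ colorDegree c v j

RainbowK4 : ∀ {n m} → EdgeColoring n m → Fin n → Fin n → Fin n → Fin n → Set
RainbowK4 c a b d e =
  Unique (a ∷ b ∷ d ∷ e ∷ []) ×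
  Unique (col c a b ∷ col c a d ∷ col c a e ∷ col c b d ∷ col c b e ∷ col c d e ∷ [])

NoRainbowK4 : ∀ {n m} → EdgeColoring n m → Set
NoRainbowK4 {n} c = ∀ (a b d e : Fin n) → ¬ RainbowK4 c a b d e

-- Blow up every vertex x of a colouring B of K_n into a copy of a colouring C of K_M,
-- giving edges between the copies of x and a the colour B(x,a). The i-degree of a
-- vertex (x,y) is then deg_C(y,i) + M·deg_B(x,i), so balance is inherited. Among the
-- vertices of a rainbow K4, no vertex r can lie outside a copy containing two others
-- p and q, since rp and rq would share the colour B(r,p); hence the K4 lies inside one
-- copy (a rainbow K4 of C) or meets four distinct copies (a rainbow K4 of B).
-- Iterating the blow-up with a suitable 6-colouring of K_13 gives K_{13^k}.
module Submission where

open import Defs renaming (sym to col-sym)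
open import Data.Nat using (ℕ; zero; suc; _+_; _*_; _^_)
open import Data.Nat.Properties as ℕ using (+-*-semiring; +-assoc; +-identityʳ; *-identityˡ; *-zeroʳ)
open import Data.Fin using (Fin; zero; suc; _≟_; _↑ˡ_; _↑ʳ_; combine; quotient; remainder)
open import Data.Fin.Properties using (all?; remQuot-combine; combine-remQuot; combine-injectiveˡ; combine-injectiveʳ)
open import Data.Fin.Patterns using (0F; 1F; 2F; 3F; 4F; 5F)
open import Data.Bool using (true; false; if_then_else_)
open import Data.List using (List; []; _∷_; length; filter; tabulate)
open import Data.List.Relation.Binary.Pointwise using (Pointwise; []; _∷_; Pointwise-≡⇒≡)
open import Data.List.Relation.Unary.All using ([]; _∷_)
open import Data.List.Relation.Unary.AllPairs using ([]; _∷_)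
open import Data.List.Relation.Unary.Unique.Propositional using (Unique)
import Data.List.Relation.Unary.Unique.DecPropositional as UniqueDec
open import Data.Vec using (Vec; []; _∷_; lookup)
open import Data.Product using (Σ; _×_; _,_; proj₁; proj₂; <_,_>)
open import Data.Sum using (_⊎_; inj₁; inj₂)
open import Function using (_∘_; id)
open import Relation.Nullary using (Dec; yes; no; does; contradiction)
open import Relation.Nullary.Decidable using (toWitness; ¬?; _×-dec_)
open import Relation.Binary.PropositionalEquality
  using (_≡_; _≢_; refl; sym; trans; cong; cong₂; subst; module ≡-Reasoning)
open import Algebra.Properties.Semiring.Sum +-*-semiring
  using (sum-syntax; sum-replicate-zero; sum-cong-≗; ∑-distrib-+; *-distribˡ-sum; *-distribʳ-sum)

open ≡-Reasoning

indicator : ∀ {p} {P : Set p} → Dec P → ℕ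
indicator P? = if does P? then 1 else 0

indicator-cong : ∀ {p q} {P : Set p} {Q : Set q} → (P → Q) → (Q → P) →
                 (P? : Dec P) (Q? : Dec Q) → indicator P? ≡ indicator Q?
indicator-cong to from (yes p) (yes q) = refl
indicator-cong to from (yes p) (no ¬q) = contradiction (to p) ¬q
indicator-cong to from (no ¬p) (yes q) = contradiction (from q) ¬p
indicator-cong to from (no ¬p) (no ¬q) = refl

length-filter-tabulate : ∀ {a p n} {A : Set a} {P : A → Set p} (P? : ∀ x → Dec (P x)) (f : Fin n → A) →
                         length (filter P? (tabulate f)) ≡ ∑[ i < n ] indicator (P? (f i))
length-filter-tabulate {n = zero}  P? f = refl
length-filter-tabulate {n = suc n} P? f with does (P? (f zero))
... | true  = cong suc (length-filter-tabulate P? (f ∘ suc))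
... | false = length-filter-tabulate P? (f ∘ suc)

∑-const : ∀ n c → ∑[ i < n ] c ≡ n * c
∑-const zero    c = refl
∑-const (suc n) c = cong (c +_) (∑-const n c)

∑-indicator-≟ : ∀ {n} (x : Fin n) → ∑[ a < n ] indicator (a ≟ x) ≡ 1
∑-indicator-≟ {suc n} zero    = cong suc (sum-replicate-zero n)
∑-indicator-≟ {suc n} (suc x) = ∑-indicator-≟ x

∑-splitAt : ∀ m n (f : Fin (m + n) → ℕ) → ∑[ i < m + n ] f i ≡ ∑[ i < m ] f (i ↑ˡ n) + ∑[ j < n ] f (m ↑ʳ j)
∑-splitAt zero    n f = refl
∑-splitAt (suc m) n f = trans (cong (f zero +_) (∑-splitAt m n (f ∘ suc))) (sym (+-assoc (f zero) _ _))

∑-combine : ∀ m n (f : Fin (m * n) → ℕ) → ∑[ k < m * n ] f k ≡ ∑[ i < m ] ∑[ j < n ] f (combine i j)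
∑-combine zero    n f = refl
∑-combine (suc m) n f = trans (∑-splitAt n (m * n) f) (cong (∑[ j < n ] f (j ↑ˡ (m * n)) +_) (∑-combine m n (f ∘ (n ↑ʳ_))))

colorDegree-as-sum : ∀ {n m} (c : EdgeColoring n m) v i →
                     colorDegree c v i ≡ ∑[ u < n ] indicator (¬? (u ≟ v) ×-dec (col c v u ≟ i))
colorDegree-as-sum c v i = length-filter-tabulate (λ u → ¬? (u ≟ v) ×-dec (col c v u ≟ i)) id

edgeColours : ∀ {n m} → EdgeColoring n m → (a b d e : Fin n) → List (Fin m)
edgeColours c a b d e = col c a b ∷ col c a d ∷ col c a e ∷ col c b d ∷ col c b e ∷ col c d e ∷ []

rainbowK4-transfer : ∀ {n n′ m} {c : EdgeColoring n m} {c′ : EdgeColoring n′ m} {a b d e a′ b′ d′ e′} →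
                     Unique (a′ ∷ b′ ∷ d′ ∷ e′ ∷ []) →
                     Pointwise _≡_ (edgeColours c a b d e) (edgeColours c′ a′ b′ d′ e′) →
                     RainbowK4 c a b d e → RainbowK4 c′ a′ b′ d′ e′
rainbowK4-transfer distinct sameColours (_ , rainbow) =
  distinct , subst Unique (Pointwise-≡⇒≡ sameColours) rainbow

rainbowK4? : ∀ {n m} (c : EdgeColoring n m) a b d e → Dec (RainbowK4 c a b d e)
rainbowK4? c a b d e = UniqueDec.unique? _≟_ _ ×-dec UniqueDec.unique? _≟_ _

module BlowUp {n M m} (B : EdgeColoring n m) (C : EdgeColoring M m) where

  block : Fin (n * M) → Fin n
  block = quotient {n} M

  position : Fin (n * M) → Fin M
  position = remainder {n} M

  block-combine : ∀ x y → block (combine x y) ≡ x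
  block-combine x y = cong proj₁ (remQuot-combine {n} {M} x y)

  position-combine : ∀ x y → position (combine x y) ≡ y
  position-combine x y = cong proj₂ (remQuot-combine {n} {M} x y)

  combine-block-position : ∀ u → combine (block u) (position u) ≡ u
  combine-block-position = combine-remQuot {n} M

  blowUpCol : Fin (n * M) → Fin (n * M) → Fin m
  blowUpCol u v with block u ≟ block v
  ... | yes _ = col C (position u) (position v)
  ... | no  _ = col B (block u) (block v)

  blowUpCol-same : ∀ {u v} → block u ≡ block v → blowUpCol u v ≡ col C (position u) (position v)
  blowUpCol-same {u} {v} eq with block u ≟ block v
  ... | yes _  = refl
  ... | no neq = contradiction eq neq

  blowUpCol-diff : ∀ {u v} → block u ≢ block v → blowUpCol u v ≡ col B (block u) (block v)
  blowUpCol-diff {u} {v} neq with block u ≟ block v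
  ... | yes eq = contradiction eq neq
  ... | no  _  = refl

  blowUpCol-sym : ∀ u v → blowUpCol u v ≡ blowUpCol v u
  blowUpCol-sym u v = by-cases (block u ≟ block v)
    where
    by-cases : Dec (block u ≡ block v) → blowUpCol u v ≡ blowUpCol v u
    by-cases (yes eq) = begin
      blowUpCol u v                   ≡⟨ blowUpCol-same eq ⟩
      col C (position u) (position v) ≡⟨ col-sym C _ _ ⟩
      col C (position v) (position u) ≡⟨ blowUpCol-same (sym eq) ⟨
      blowUpCol v u                   ∎
    by-cases (no neq) = begin
      blowUpCol u v                   ≡⟨ blowUpCol-diff neq ⟩
      col B (block u) (block v)       ≡⟨ col-sym B _ _ ⟩
      col B (block v) (block u)       ≡⟨ blowUpCol-diff (neq ∘ sym) ⟨
      blowUpCol v u                   ∎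

  blowUp : EdgeColoring (n * M) m
  blowUp = record { col = blowUpCol ; sym = blowUpCol-sym }

  blowUpCol-combine-same : ∀ x y b → blowUpCol (combine x y) (combine x b) ≡ col C y b
  blowUpCol-combine-same x y b = begin
    blowUpCol (combine x y) (combine x b)
      ≡⟨ blowUpCol-same (trans (block-combine x y) (sym (block-combine x b))) ⟩
    col C (position (combine x y)) (position (combine x b))
      ≡⟨ cong₂ (col C) (position-combine x y) (position-combine x b) ⟩
    col C y b ∎

  blowUpCol-combine-diff : ∀ {x a} y b → x ≢ a → blowUpCol (combine x y) (combine a b) ≡ col B x a
  blowUpCol-combine-diff {x} {a} y b x≢a = begin
    blowUpCol (combine x y) (combine a b)
      ≡⟨ blowUpCol-diff (λ eq → x≢a (trans (sym (block-combine x y)) (trans eq (block-combine a b)))) ⟩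
    col B (block (combine x y)) (block (combine a b))
      ≡⟨ cong₂ (col B) (block-combine x y) (block-combine a b) ⟩
    col B x a ∎

  colorDegree-blowUp : ∀ x y i → colorDegree blowUp (combine x y) i ≡ colorDegree C y i + M * colorDegree B x i
  colorDegree-blowUp x y i = begin
    colorDegree blowUp v i
      ≡⟨ colorDegree-as-sum blowUp v i ⟩
    ∑[ u < n * M ] edgeAt u
      ≡⟨ ∑-combine n M edgeAt ⟩
    ∑[ a < n ] ∑[ b < M ] edgeAt (combine a b)
      ≡⟨ sum-cong-≗ (λ a → edgesToBlock a (a ≟ x)) ⟩
    ∑[ a < n ] (indicator (a ≟ x) * degC + M * edgeInB a)
      ≡⟨ ∑-distrib-+ (λ a → indicator (a ≟ x) * degC) (λ a → M * edgeInB a) ⟩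
    ∑[ a < n ] (indicator (a ≟ x) * degC) + ∑[ a < n ] (M * edgeInB a)
      ≡⟨ cong₂ _+_ (*-distribʳ-sum degC (λ a → indicator (a ≟ x))) (*-distribˡ-sum M edgeInB) ⟨
    (∑[ a < n ] indicator (a ≟ x)) * degC + M * ∑[ a < n ] edgeInB a
      ≡⟨ cong₂ (λ s t → s * degC + M * t) (∑-indicator-≟ x) (sym (colorDegree-as-sum B x i)) ⟩
    1 * degC + M * colorDegree B x i
      ≡⟨ cong (_+ M * colorDegree B x i) (*-identityˡ degC) ⟩
    degC + M * colorDegree B x i ∎
    where
    v = combine x y
    degC = colorDegree C y i

    edgeAt : Fin (n * M) → ℕ
    edgeAt u = indicator (¬? (u ≟ v) ×-dec (blowUpCol v u ≟ i))

    edgeInB : Fin n → ℕ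
    edgeInB a = indicator (¬? (a ≟ x) ×-dec (col B x a ≟ i))

    edgesToBlock : ∀ a (a≟x : Dec (a ≡ x)) →
      ∑[ b < M ] edgeAt (combine a b) ≡ indicator a≟x * degC + M * indicator (¬? a≟x ×-dec (col B x a ≟ i))
    edgesToBlock a (yes refl) = begin
      ∑[ b < M ] edgeAt (combine x b)
        ≡⟨ sum-cong-≗ inOwnBlock ⟩
      ∑[ b < M ] indicator (¬? (b ≟ y) ×-dec (col C y b ≟ i))
        ≡⟨ colorDegree-as-sum C y i ⟨
      degC
        ≡⟨ trans (cong₂ _+_ (*-identityˡ degC) (*-zeroʳ M)) (+-identityʳ degC) ⟨
      1 * degC + M * 0 ∎
      where
      inOwnBlock : ∀ b → edgeAt (combine x b) ≡ indicator (¬? (b ≟ y) ×-dec (col C y b ≟ i))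
      inOwnBlock b = indicator-cong
        < (λ ne → ne ∘ cong (combine x)) ∘ proj₁ , (λ e → trans (sym (blowUpCol-combine-same x y b)) e) ∘ proj₂ >
        < (λ ne → ne ∘ combine-injectiveʳ x b x y) ∘ proj₁ , trans (blowUpCol-combine-same x y b) ∘ proj₂ >
        (¬? (combine x b ≟ v) ×-dec (blowUpCol v (combine x b) ≟ i)) (¬? (b ≟ y) ×-dec (col C y b ≟ i))
    edgesToBlock a (no a≢x) = begin
      ∑[ b < M ] edgeAt (combine a b)
        ≡⟨ sum-cong-≗ inOtherBlock ⟩
      ∑[ b < M ] indicator (col B x a ≟ i)
        ≡⟨ ∑-const M _ ⟩
      M * indicator (col B x a ≟ i) ∎
      where
      colourTo : ∀ b → blowUpCol v (combine a b) ≡ col B x a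
      colourTo b = blowUpCol-combine-diff y b (a≢x ∘ sym)

      inOtherBlock : ∀ b → edgeAt (combine a b) ≡ indicator (col B x a ≟ i)
      inOtherBlock b = indicator-cong
        (trans (sym (colourTo b)) ∘ proj₂)
        < (λ _ eq → a≢x (combine-injectiveˡ a b x y eq)) , trans (colourTo b) >
        (¬? (combine a b ≟ v) ×-dec (blowUpCol v (combine a b) ≟ i)) (col B x a ≟ i)

  blowUp-balanced : Balanced B → Balanced C → Balanced blowUp
  blowUp-balanced balB balC v i j = begin
    colorDegree blowUp v i                    ≡⟨ cong (λ w → colorDegree blowUp w i) (combine-block-position v) ⟨
    colorDegree blowUp (combine x y) i        ≡⟨ colorDegree-blowUp x y i ⟩
    colorDegree C y i + M * colorDegree B x i ≡⟨ cong₂ (λ s t → s + M * t) (balC y i j) (balB x i j) ⟩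
    colorDegree C y j + M * colorDegree B x j ≡⟨ colorDegree-blowUp x y j ⟨
    colorDegree blowUp (combine x y) j        ≡⟨ cong (λ w → colorDegree blowUp w j) (combine-block-position v) ⟩
    colorDegree blowUp v j                    ∎
    where
    x = block v
    y = position v

  block-position-injective : ∀ {u v} → block u ≡ block v → position u ≡ position v → u ≡ v
  block-position-injective {u} {v} u~v eq = begin
    u                               ≡⟨ combine-block-position u ⟨
    combine (block u) (position u)  ≡⟨ cong₂ combine u~v eq ⟩
    combine (block v) (position v)  ≡⟨ combine-block-position v ⟩
    v                               ∎

  blowUpCol-fanˡ : ∀ {r p q} → block p ≡ block q → block r ≢ block p → blowUpCol r p ≡ blowUpCol r q
  blowUpCol-fanˡ {r} {p} {q} p~q r≁p = begin
    blowUpCol r p             ≡⟨ blowUpCol-diff r≁p ⟩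
    col B (block r) (block p) ≡⟨ cong (col B (block r)) p~q ⟩
    col B (block r) (block q) ≡⟨ blowUpCol-diff (λ r~q → r≁p (trans r~q (sym p~q))) ⟨
    blowUpCol r q             ∎

  blowUpCol-fanʳ : ∀ {r p q} → block p ≡ block q → block r ≢ block p → blowUpCol p r ≡ blowUpCol q r
  blowUpCol-fanʳ {r} {p} {q} p~q r≁p =
    trans (blowUpCol-sym p r) (trans (blowUpCol-fanˡ p~q r≁p) (blowUpCol-sym r q))

  rainbowK4-blocks-equal-or-distinct : ∀ {a b d e} → RainbowK4 blowUp a b d e →
    (block a ≡ block b × block a ≡ block d × block a ≡ block e) ⊎
    Unique (block a ∷ block b ∷ block d ∷ block e ∷ [])
  rainbowK4-blocks-equal-or-distinct {a} {b} {d} {e}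
    (_ , (ab≢ad ∷ ab≢ae ∷ ab≢bd ∷ ab≢be ∷ _ ∷ []) ∷ (ad≢ae ∷ ad≢bd ∷ _ ∷ _ ∷ []) ∷ (_ ∷ ae≢be ∷ _ ∷ []) ∷ _) =
    classify (block a ≟ block b) (block a ≟ block d) (block a ≟ block e)
             (block b ≟ block d) (block b ≟ block e) (block d ≟ block e)
    where
    -- A `with` here would also abstract the tests hidden inside `blowUpCol` in the
    -- types of the colour inequalities.
    classify : Dec (block a ≡ block b) → Dec (block a ≡ block d) → Dec (block a ≡ block e) →
               Dec (block b ≡ block d) → Dec (block b ≡ block e) → Dec (block d ≡ block e) →
               (block a ≡ block b × block a ≡ block d × block a ≡ block e) ⊎
               Unique (block a ∷ block b ∷ block d ∷ block e ∷ [])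
    classify (yes a~b) (yes a~d) (yes a~e) _ _ _ = inj₁ (a~b , a~d , a~e)
    classify (yes a~b) (no a≁d) _ _ _ _ = contradiction (blowUpCol-fanʳ a~b (a≁d ∘ sym)) ad≢bd
    classify (yes a~b) (yes _) (no a≁e) _ _ _ = contradiction (blowUpCol-fanʳ a~b (a≁e ∘ sym)) ae≢be
    classify (no a≁b) (yes a~d) _ _ _ _ =
      contradiction (trans (blowUpCol-sym a b) (blowUpCol-fanˡ a~d (a≁b ∘ sym))) ab≢bd
    classify (no a≁b) (no _) (yes a~e) _ _ _ =
      contradiction (trans (blowUpCol-sym a b) (blowUpCol-fanˡ a~e (a≁b ∘ sym))) ab≢be
    classify (no a≁b) (no _) (no _) (yes b~d) _ _ = contradiction (blowUpCol-fanˡ b~d a≁b) ab≢ad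
    classify (no a≁b) (no _) (no _) (no _) (yes b~e) _ = contradiction (blowUpCol-fanˡ b~e a≁b) ab≢ae
    classify (no _) (no a≁d) (no _) (no _) (no _) (yes d~e) = contradiction (blowUpCol-fanˡ d~e a≁d) ad≢ae
    classify (no a≁b) (no a≁d) (no a≁e) (no b≁d) (no b≁e) (no d≁e) =
      inj₂ ((a≁b ∷ a≁d ∷ a≁e ∷ []) ∷ (b≁d ∷ b≁e ∷ []) ∷ (d≁e ∷ []) ∷ [] ∷ [])

  rainbowK4-within-block : ∀ {a b d e} → block a ≡ block b → block a ≡ block d → block a ≡ block e →
    RainbowK4 blowUp a b d e → RainbowK4 C (position a) (position b) (position d) (position e)
  rainbowK4-within-block a~b a~d a~e
    rainbow@((a≢b ∷ a≢d ∷ a≢e ∷ []) ∷ (b≢d ∷ b≢e ∷ []) ∷ (d≢e ∷ []) ∷ [] ∷ [] , _) =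
    rainbowK4-transfer {c = blowUp} {c′ = C}
      ((apart a~b a≢b ∷ apart a~d a≢d ∷ apart a~e a≢e ∷ []) ∷
       (apart b~d b≢d ∷ apart b~e b≢e ∷ []) ∷ (apart d~e d≢e ∷ []) ∷ [] ∷ [])
      (blowUpCol-same a~b ∷ blowUpCol-same a~d ∷ blowUpCol-same a~e ∷
       blowUpCol-same b~d ∷ blowUpCol-same b~e ∷ blowUpCol-same d~e ∷ [])
      rainbow
    where
    b~d = trans (sym a~b) a~d
    b~e = trans (sym a~b) a~e
    d~e = trans (sym a~d) a~e
    apart : ∀ {u v} → block u ≡ block v → u ≢ v → position u ≢ position v
    apart u~v u≢v = u≢v ∘ block-position-injective u~v

  rainbowK4-across-blocks : ∀ {a b d e} → Unique (block a ∷ block b ∷ block d ∷ block e ∷ []) →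
    RainbowK4 blowUp a b d e → RainbowK4 B (block a) (block b) (block d) (block e)
  rainbowK4-across-blocks distinct@((a≁b ∷ a≁d ∷ a≁e ∷ []) ∷ (b≁d ∷ b≁e ∷ []) ∷ (d≁e ∷ []) ∷ [] ∷ []) =
    rainbowK4-transfer {c = blowUp} {c′ = B} distinct
      (blowUpCol-diff a≁b ∷ blowUpCol-diff a≁d ∷ blowUpCol-diff a≁e ∷
       blowUpCol-diff b≁d ∷ blowUpCol-diff b≁e ∷ blowUpCol-diff d≁e ∷ [])

  blowUp-noRainbowK4 : NoRainbowK4 B → NoRainbowK4 C → NoRainbowK4 blowUp
  blowUp-noRainbowK4 noB noC a b d e rainbow with rainbowK4-blocks-equal-or-distinct rainbow
  ... | inj₁ (a~b , a~d , a~e) = noC _ _ _ _ (rainbowK4-within-block a~b a~d a~e rainbow)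
  ... | inj₂ distinct          = noB _ _ _ _ (rainbowK4-across-blocks distinct rainbow)

open BlowUp using (blowUp; blowUp-balanced; blowUp-noRainbowK4)

K₁₃-table : Vec (Vec (Fin 6) 13) 13
K₁₃-table =
    (0F ∷ 0F ∷ 1F ∷ 4F ∷ 2F ∷ 3F ∷ 5F ∷ 5F ∷ 3F ∷ 2F ∷ 4F ∷ 1F ∷ 0F ∷ []) ∷
    (0F ∷ 0F ∷ 2F ∷ 0F ∷ 5F ∷ 1F ∷ 3F ∷ 1F ∷ 4F ∷ 2F ∷ 3F ∷ 4F ∷ 5F ∷ []) ∷
    (1F ∷ 2F ∷ 0F ∷ 5F ∷ 3F ∷ 3F ∷ 1F ∷ 4F ∷ 0F ∷ 5F ∷ 2F ∷ 0F ∷ 4F ∷ []) ∷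
    (4F ∷ 0F ∷ 5F ∷ 0F ∷ 1F ∷ 1F ∷ 0F ∷ 2F ∷ 5F ∷ 4F ∷ 3F ∷ 2F ∷ 3F ∷ []) ∷
    (2F ∷ 5F ∷ 3F ∷ 1F ∷ 0F ∷ 0F ∷ 0F ∷ 3F ∷ 4F ∷ 1F ∷ 4F ∷ 5F ∷ 2F ∷ []) ∷
    (3F ∷ 1F ∷ 3F ∷ 1F ∷ 0F ∷ 0F ∷ 5F ∷ 2F ∷ 2F ∷ 4F ∷ 5F ∷ 0F ∷ 4F ∷ []) ∷
    (5F ∷ 3F ∷ 1F ∷ 0F ∷ 0F ∷ 5F ∷ 0F ∷ 4F ∷ 2F ∷ 3F ∷ 2F ∷ 4F ∷ 1F ∷ []) ∷
    (5F ∷ 1F ∷ 4F ∷ 2F ∷ 3F ∷ 2F ∷ 4F ∷ 0F ∷ 5F ∷ 0F ∷ 0F ∷ 1F ∷ 3F ∷ []) ∷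
    (3F ∷ 4F ∷ 0F ∷ 5F ∷ 4F ∷ 2F ∷ 2F ∷ 5F ∷ 0F ∷ 0F ∷ 1F ∷ 3F ∷ 1F ∷ []) ∷
    (2F ∷ 2F ∷ 5F ∷ 4F ∷ 1F ∷ 4F ∷ 3F ∷ 0F ∷ 0F ∷ 0F ∷ 1F ∷ 3F ∷ 5F ∷ []) ∷
    (4F ∷ 3F ∷ 2F ∷ 3F ∷ 4F ∷ 5F ∷ 2F ∷ 0F ∷ 1F ∷ 1F ∷ 0F ∷ 5F ∷ 0F ∷ []) ∷
    (1F ∷ 4F ∷ 0F ∷ 2F ∷ 5F ∷ 0F ∷ 4F ∷ 1F ∷ 3F ∷ 3F ∷ 5F ∷ 0F ∷ 2F ∷ []) ∷
    (0F ∷ 5F ∷ 4F ∷ 3F ∷ 2F ∷ 4F ∷ 1F ∷ 3F ∷ 1F ∷ 5F ∷ 0F ∷ 2F ∷ 0F ∷ []) ∷ []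

K₁₃ : EdgeColoring 13 6
K₁₃ = record
  { col = λ u v → lookup (lookup K₁₃-table u) v
  ; sym = toWitness {a? = all? λ u → all? λ v → lookup (lookup K₁₃-table u) v ≟ lookup (lookup K₁₃-table v) u} _
  }

K₁₃-balanced : Balanced K₁₃
K₁₃-balanced = toWitness {a? = all? λ v → all? λ i → all? λ j → colorDegree K₁₃ v i ℕ.≟ colorDegree K₁₃ v j} _

K₁₃-noRainbowK4 : NoRainbowK4 K₁₃
K₁₃-noRainbowK4 = toWitness {a? = all? λ a → all? λ b → all? λ d → all? λ e → ¬? (rainbowK4? K₁₃ a b d e)} _

tower : ∀ k → EdgeColoring (13 ^ suc k) 6
tower zero    = K₁₃
tower (suc k) = blowUp K₁₃ (tower k)

tower-balanced : ∀ k → Balanced (tower k)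
tower-balanced zero    = K₁₃-balanced
tower-balanced (suc k) = blowUp-balanced K₁₃ (tower k) K₁₃-balanced (tower-balanced k)

tower-noRainbowK4 : ∀ k → NoRainbowK4 (tower k)
tower-noRainbowK4 zero    = K₁₃-noRainbowK4
tower-noRainbowK4 (suc k) = blowUp-noRainbowK4 K₁₃ (tower k) K₁₃-noRainbowK4 (tower-noRainbowK4 k)

theorem1 : (k : ℕ) → Σ (EdgeColoring (13 ^ suc k) 6) (λ c → Balanced c × NoRainbowK4 c)
theorem1 k = tower k , tower-balanced k , tower-noRainbowK4 k
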